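{- Let $F$ be a filling of the Young diagram of a partition $\mu=(\mu_1\ge\mu_2\ge\cdots\ge\mu_k)$ with positive integers, and let $R_1,R_2,\ldots,R_k$ be its rows from bottom to top ($R_i$ a word of length $\mu_i$, read left to right). Let $\psi(F)$ be the filling of the same shape with rows $R_1',\ldots,R_k'$ (bottom to top) defined recursively by $R_1'=R_1$ and $R_i'=\psi_{R_{i-1}'}(R_i)$ for $i\ge2$. Then \[ \sum_{i=1}^k \operatorname{inv}(R_i)=\operatorname{inv}(\psi(F)), \] where on the left $\operatorname{inv}$ of a word is its usual number of inversions and on the right $\operatorname{inv}$ is the inversion statistic on fillings.
   Context: Words: for a word $w=w_1\cdots w_n$ over $\mathbb{Z}_+$, $\operatorname{inv}(w)=|\{(i,j): i<j,\ w_i>w_j\}|$, and $w_{[i,j]}=w_iw_{i+1}\cdots w_j$. Basement lift maps: for $i\in\mathbb{Z}_+$ and any length $n$, $B_i$ sends $w$ to the word with $(B_i(w))_j=i$ iff $w_{n+1-j}=i$, and whose subword of letters $\ne i$ equals that of $w$ (positions of the letters $i$ are reflected, other letters keep their order). For integers $0\le i<j$ put $B_{i\to j}=B_j\circ B_{j-1}\circ\cdots\circ B_{i+1}$ and $B_{j\to i}=B_{i\to j}^{ -1}=B_{i+1}^{ -1}\circ\cdots\circ B_j^{ -1}$; $B_{i\to i}$ is the identity. Elevator map: for $m\ge n$ and a word $a=a_1\cdots a_m$, $\psi_a$ maps a word $w$ of length $n$ as follows: $w^{(1)}=B_{0\to a_1}(w)$, and for $2\le i\le n$, $w^{(i)}=w^{(i-1)}_{[1,i-1]}\cdot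 B_{a_{i-1}\to a_i}\big(w^{(i-1)}_{[i,n]}\big)$ (apply $B_{a_{i-1}\to a_i}$ to the last $n-i+1$ letters, keeping the first $i-1$ letters); set $\psi_a(w)=w^{(n)}$. Fillings: a filling of shape $\mu$ assigns a positive integer to each cell of the Young diagram, drawn with row 1 (of length $\mu_1$) at the bottom and rows left-justified. Inversion statistic on fillings: an inversion triple is a triple of cells $x,y,z$ where $x$ and $y$ lie in the same row with $x$ strictly left of $y$, and $z$ is the cell directly below $x$, such that (writing the entries as $x,y,z$) $x=z\ne y$, or $x>y>z$, or $y>z>x$, or $z>x>y$. An inversion pair is a pair of cells $x,y$ in the bottom row with $x$ strictly left of $y$ and $x>y$. Then $\operatorname{inv}(F)$ is the number of inversion triples plus the number of inversion pairs. -}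

module Defs where

open import Data.Nat using (ℕ; zero; suc; _+_; _≤_; _<_; _≡ᵇ_; _<ᵇ_; _≤ᵇ_; _∸_)
open import Data.Bool using (Bool; true; false; if_then_else_; _∧_; _∨_; not)
open import Data.List using (List; []; _∷_; length; reverse; map; zip)
open import Data.List.Relation.Unary.All using (All)
open import Data.Product using (_×_; _,_; proj₁)

-- Words over ℤ₊ are lists of naturals (positivity is a hypothesis where needed).
Word : Set
Word = List ℕ

count : {A : Set} → (A → Bool) → List A → ℕ
count p [] = 0
count p (x ∷ xs) = (if p x then 1 else 0) + count p xs

inv : Word → ℕ
inv [] = 0
inv (x ∷ xs) = count (λ y → y <ᵇ x) xs + inv xs

fillB : ℕ → Word → Word → Word
fillB i [] q = []
fillB i (x ∷ xs) q with x ≡ᵇ i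
... | true = i ∷ fillB i xs q
fillB i (x ∷ xs) [] | false = 0 ∷ fillB i xs []   -- unreachable (queue never runs out)
fillB i (x ∷ xs) (y ∷ q) | false = y ∷ fillB i xs q

others : ℕ → Word → Word
others i [] = []
others i (x ∷ xs) = if x ≡ᵇ i then others i xs else x ∷ others i xs

-- (B_i w)_j = i  iff  w_{n+1-j} = i, and the subword of letters ≠ i is that of w
B : ℕ → Word → Word
B i w = fillB i (reverse w) (others i w)

-- The inverse B_i^{-1}: the word v with B_i v = w is obtained by the same
-- reflection (B_i is an involution: reflecting the i-positions twice is the
-- identity and the subword of letters ≠ i is unchanged).
Binv : ℕ → Word → Word
Binv i w = fillB i (reverse w) (others i w)

-- B_{i→j} = B_j ∘ ⋯ ∘ B_{i+1}   (apply B_{i+1} first), for i ≤ j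
-- upLift i k w applies B_{i+1}, …, B_{i+k} in this order
upLift : ℕ → ℕ → Word → Word
upLift i zero w = w
upLift i (suc k) w = upLift (suc i) k (B (suc i) w)

-- B_{j→i} = B_{i+1}^{-1} ∘ ⋯ ∘ B_j^{-1}  (apply B_j^{-1} first), for i ≤ j
-- downLift j k w applies B_j^{-1}, B_{j-1}^{-1}, …, B_{j-k+1}^{-1} in this order
downLift : ℕ → ℕ → Word → Word
downLift j zero w = w
downLift zero (suc k) w = w   -- unreachable when k < j
downLift (suc j) (suc k) w = downLift j k (Binv (suc j) w)

Bto : ℕ → ℕ → Word → Word
Bto a b w = if a ≤ᵇ b then upLift a (b ∸ a) w else downLift a (a ∸ b) w

-- Elevator map ψ_a.
-- elevGo p a w : previous letter p (a_0 = 0), remaining letters a of the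
-- basement word, current suffix w; apply B_{p→a_i} to the suffix, fix its
-- first letter and continue.
elevGo : ℕ → Word → Word → Word
elevGo p [] w = w   -- only reached with w = [] when length a ≥ length w
elevGo p (a ∷ as) w with Bto p a w
... | [] = []
... | x ∷ xs = x ∷ elevGo a as xs

ψ : Word → Word → Word
ψ a w = elevGo 0 a w

-- Fillings: list of rows, bottom row first.
Filling : Set
Filling = List Word

Decreasing : List Word → Set
Decreasing [] = ⊤'
  where open import Data.Unit using () renaming (⊤ to ⊤')
Decreasing (r ∷ []) = ⊤'
  where open import Data.Unit using () renaming (⊤ to ⊤')
Decreasing (r ∷ s ∷ rs) = (length s ≤ length r) × Decreasing (s ∷ rs)

IsFilling : Filling → Set
IsFilling F = All (λ r → 1 ≤ length r) F × Decreasing F × All (All (1 ≤_)) F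

ψRows : Word → List Word → List Word
ψRows prev [] = []
ψRows prev (r ∷ rs) = let r' = ψ prev r in r' ∷ ψRows r' rs

ψF : Filling → Filling
ψF [] = []
ψF (r ∷ rs) = r ∷ ψRows r rs

-- condition for an inversion triple with entries x (upper-left), y (upper-right),
-- z (below x): x = z ≠ y, or x>y>z, or y>z>x, or z>x>y
tripleCond : ℕ → ℕ → ℕ → Bool
tripleCond x y z =
  ((x ≡ᵇ z) ∧ not (x ≡ᵇ y)) ∨ ((y <ᵇ x) ∧ (z <ᵇ y))
  ∨ ((z <ᵇ y) ∧ (x <ᵇ z)) ∨ ((x <ᵇ z) ∧ (y <ᵇ x))

-- triples given the list of (x, z) = (upper entry, entry below) columnwise
triplesCols : List (ℕ × ℕ) → ℕ
triplesCols [] = 0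
triplesCols ((x , z) ∷ rest) =
  count (λ y → tripleCond x y z) (map proj₁ rest) + triplesCols rest

triplesRow : Word → Word → ℕ
triplesRow lower upper = triplesCols (zip upper lower)

triplesAll : Word → List Word → ℕ
triplesAll lower [] = 0
triplesAll lower (r ∷ rs) = triplesRow lower r + triplesAll r rs

pairsBottom : Word → ℕ
pairsBottom [] = 0
pairsBottom (x ∷ xs) = count (λ y → y <ᵇ x) xs + pairsBottom xs

invF : Filling → ℕ
invF [] = 0
invF (r ∷ rs) = pairsBottom r + triplesAll r rs

-- Compare each row with a constant row below it: triplesOver z w counts the inversion triples of
-- w over a row of z's. Split w into its letters c = j+1 and the others. Among the other letters the
-- triples are the same over c as over j. The triples involving a letter c are the pairs
-- "c before a non-c" over the basement c, and the pairs "non-c before c" over the basement j; the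
-- lift B_c reflects the positions of the letters c and so exchanges these two counts. Hence
-- B_{a→b} turns triplesOver a into triplesOver b, and it permutes letters. In ψ_a(w) the entry above
-- a_i heads B_{a_{i-1}→a_i} of the current suffix and the entries to its right rearrange the rest of
-- that suffix, so the triples between a and ψ_a(w) telescope to triplesOver 0 w = inv w.
module Submission where

open import Defs
open import Data.Bool using (Bool; true; false; T; if_then_else_; _∧_; _∨_; not)
open import Data.Bool.Properties using (∧-identityʳ; ∨-identityʳ)
open import Data.Nat using (ℕ; zero; suc; pred; _+_; _∸_; _≤_; _≡ᵇ_; _<ᵇ_; _≤ᵇ_; s≤s)
open import Data.Nat.Properties
  using (+-comm; +-assoc; +-suc; +-identityʳ; ≡ᵇ⇒≡; ≤ᵇ⇒≤; ≤⇒≤ᵇ; ≰⇒≥; ≤-pred; m+[n∸m]≡n; m∸[m∸n]≡n; m∸n≤m)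
open import Data.Nat.ListAction using (sum)
open import Data.Nat.Solver using (module +-*-Solver)
open import Data.List using (List; []; _∷_; length; reverse; map; zip; _++_)
open import Data.List.Properties using (unfold-reverse; reverse-map)
open import Data.List.Relation.Unary.All using (All; []; _∷_)
import Data.List.Relation.Unary.All as All
open import Data.Product using (_×_; _,_; proj₁; proj₂)
open import Data.Unit using (tt)
open import Function using (_∘_; flip)
open import Relation.Binary.PropositionalEquality
  using (_≡_; refl; sym; trans; cong; cong₂; subst; module ≡-Reasoning)

open +-*-Solver using (solve; _:+_; _:=_; con)

≡ᵇ-refl : ∀ c → (c ≡ᵇ c) ≡ true
≡ᵇ-refl zero = refl
≡ᵇ-refl (suc c) = ≡ᵇ-refl c

≡ᵇ-true⇒≡ : ∀ x c → (x ≡ᵇ c) ≡ true → x ≡ c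
≡ᵇ-true⇒≡ x c eq = ≡ᵇ⇒≡ x c (subst T (sym eq) tt)

≤ᵇ-true⇒≤ : ∀ a b → (a ≤ᵇ b) ≡ true → a ≤ b
≤ᵇ-true⇒≤ a b eq = ≤ᵇ⇒≤ a b (subst T (sym eq) tt)

≤ᵇ-false⇒≥ : ∀ a b → (a ≤ᵇ b) ≡ false → b ≤ a
≤ᵇ-false⇒≥ a b eq = ≰⇒≥ (λ a≤b → subst T eq (≤⇒≤ᵇ a≤b))

1+c≡ᵇc : ∀ c → (suc c ≡ᵇ c) ≡ false
1+c≡ᵇc zero = refl
1+c≡ᵇc (suc c) = 1+c≡ᵇc c

1+c<ᵇc : ∀ c → (suc c <ᵇ c) ≡ false
1+c<ᵇc zero = refl
1+c<ᵇc (suc c) = 1+c<ᵇc c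

c<ᵇ1+c : ∀ c → (c <ᵇ suc c) ≡ true
c<ᵇ1+c zero = refl
c<ᵇ1+c (suc c) = c<ᵇ1+c c

<ᵇ-suc : ∀ x j → (x <ᵇ suc j) ≡ (x ≡ᵇ j) ∨ (x <ᵇ j)
<ᵇ-suc zero zero = refl
<ᵇ-suc zero (suc j) = refl
<ᵇ-suc (suc x) zero = refl
<ᵇ-suc (suc x) (suc j) = <ᵇ-suc x j

1+j<ᵇy : ∀ j y → (y ≡ᵇ suc j) ≡ false → (suc j <ᵇ y) ≡ (j <ᵇ y)
1+j<ᵇy j zero _ = refl
1+j<ᵇy zero (suc zero) ()
1+j<ᵇy zero (suc (suc y)) _ = refl
1+j<ᵇy (suc j) (suc y) h = 1+j<ᵇy j y h

≡ᵇ∧<ᵇ : ∀ y c → (y ≡ᵇ c) ∧ (c <ᵇ y) ≡ false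
≡ᵇ∧<ᵇ zero zero = refl
≡ᵇ∧<ᵇ zero (suc c) = refl
≡ᵇ∧<ᵇ (suc y) zero = refl
≡ᵇ∧<ᵇ (suc y) (suc c) = ≡ᵇ∧<ᵇ y c

≡ᵇ∧-subst : ∀ (p : ℕ → Bool) y c → (y ≡ᵇ c) ∧ p y ≡ (y ≡ᵇ c) ∧ p c
≡ᵇ∧-subst p y c with y ≡ᵇ c in eq
... | false = refl
... | true = cong p (≡ᵇ-true⇒≡ y c eq)

module _ {A : Set} where

  count-++ : (p : A → Bool) (l m : List A) → count p (l ++ m) ≡ count p l + count p m
  count-++ p [] m = refl
  count-++ p (x ∷ l) m rewrite count-++ p l m = sym (+-assoc (if p x then 1 else 0) (count p l) (count p m))

  count-reverse : (p : A → Bool) (l : List A) → count p (reverse l) ≡ count p l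
  count-reverse p [] = refl
  count-reverse p (x ∷ l)
    rewrite unfold-reverse x l | count-++ p (reverse l) (x ∷ []) | count-reverse p l
    = trans (+-comm (count p l) _) (cong (_+ count p l) (+-identityʳ _))

  count-map : {B : Set} (p : B → Bool) (f : A → B) (l : List A) → count p (map f l) ≡ count (p ∘ f) l
  count-map p f [] = refl
  count-map p f (x ∷ l) = cong ((if p (f x) then 1 else 0) +_) (count-map p f l)

  count-cong : {p q : A → Bool} (l : List A) → All (λ y → p y ≡ q y) l → count p l ≡ count q l
  count-cong [] [] = refl
  count-cong {q = q} (x ∷ l) (h ∷ hs) rewrite h = cong ((if q x then 1 else 0) +_) (count-cong l hs)

  count-length : (l : List A) → count (λ _ → true) l ≡ length l
  count-length [] = refl
  count-length (x ∷ l) = cong suc (count-length l)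

invBy : {A : Set} → (A → A → Bool) → List A → ℕ
invBy t [] = 0
invBy t (x ∷ xs) = count (t x) xs + invBy t xs

module _ {A : Set} where

  invBy-cong-on : (P : A → Set) {t s : A → A → Bool} (l : List A) → All P l →
                  (∀ {x y} → P x → P y → t x y ≡ s x y) → invBy t l ≡ invBy s l
  invBy-cong-on P [] [] _ = refl
  invBy-cong-on P (x ∷ l) (px ∷ pl) h =
    cong₂ _+_ (count-cong l (All.map (h px) pl)) (invBy-cong-on P l pl h)

  invBy-cong : {t s : A → A → Bool} → (∀ x y → t x y ≡ s x y) → (l : List A) → invBy t l ≡ invBy s l
  invBy-cong h [] = refl
  invBy-cong h (x ∷ l) = cong₂ _+_ (count-cong l (All.universal (h x) l)) (invBy-cong h l)

  invBy-map : {B : Set} (t : B → B → Bool) (f : A → B) (l : List A) →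
              invBy t (map f l) ≡ invBy (λ x y → t (f x) (f y)) l
  invBy-map t f [] = refl
  invBy-map t f (x ∷ l) = cong₂ _+_ (count-map (t (f x)) f l) (invBy-map t f l)

  invBy-∷ʳ : (t : A → A → Bool) (l : List A) (x : A) →
             invBy t (l ++ x ∷ []) ≡ invBy t l + count (λ y → t y x) l
  invBy-∷ʳ t [] x = refl
  invBy-∷ʳ t (y ∷ l) x rewrite count-++ (t y) l (x ∷ []) | invBy-∷ʳ t l x =
    solve 4 (λ m e n k → (m :+ (e :+ con 0)) :+ (n :+ k) := (m :+ n) :+ (e :+ k)) refl
      (count (t y) l) (if t y x then 1 else 0) (invBy t l) (count (λ z → t z x) l)

  invBy-reverse : (t : A → A → Bool) (l : List A) → invBy t (reverse l) ≡ invBy (flip t) l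
  invBy-reverse t [] = refl
  invBy-reverse t (x ∷ l)
    rewrite unfold-reverse x l | invBy-∷ʳ t (reverse l) x | invBy-reverse t l | count-reverse (λ y → t y x) l
    = +-comm (invBy (flip t) l) _

count-others : (p : ℕ → Bool) (c : ℕ) (w : Word) →
               count p w ≡ count p (others c w) + count (λ y → (y ≡ᵇ c) ∧ p y) w
count-others p c [] = refl
count-others p c (x ∷ xs) with x ≡ᵇ c
... | true = trans (cong ((if p x then 1 else 0) +_) (count-others p c xs))
                   (solve 3 (λ e m n → e :+ (m :+ n) := m :+ (e :+ n)) refl
                     (if p x then 1 else 0) (count p (others c xs)) (count (λ y → (y ≡ᵇ c) ∧ p y) xs))
... | false = trans (cong ((if p x then 1 else 0) +_) (count-others p c xs))
                    (sym (+-assoc (if p x then 1 else 0) _ _))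

involving : ℕ → (ℕ → ℕ → Bool) → ℕ → ℕ → Bool
involving c t x y = ((x ≡ᵇ c) ∨ (y ≡ᵇ c)) ∧ t x y

invBy-others : (t : ℕ → ℕ → Bool) (c : ℕ) (w : Word) →
               invBy t w ≡ invBy t (others c w) + invBy (involving c t) w
invBy-others t c [] = refl
invBy-others t c (x ∷ xs) with x ≡ᵇ c
... | true = trans (cong (count (t x) xs +_) (invBy-others t c xs))
                   (solve 3 (λ m n k → m :+ (n :+ k) := n :+ (m :+ k)) refl
                     (count (t x) xs) (invBy t (others c xs)) (invBy (involving c t) xs))
... | false = trans (cong₂ _+_ (count-others (t x) c xs) (invBy-others t c xs))
                    (solve 4 (λ a b m n → (a :+ b) :+ (m :+ n) := (a :+ m) :+ (b :+ n)) refl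
                      (count (t x) (others c xs)) (count (λ y → (y ≡ᵇ c) ∧ t x y) xs)
                      (invBy t (others c xs)) (invBy (involving c t) xs))

length-others : (c : ℕ) (w : Word) → length (others c w) ≡ count (not ∘ (_≡ᵇ c)) w
length-others c [] = refl
length-others c (x ∷ xs) with x ≡ᵇ c
... | true = length-others c xs
... | false = cong suc (length-others c xs)

others-avoids : (c : ℕ) (w : Word) → All (λ t → (t ≡ᵇ c) ≡ false) (others c w)
others-avoids c [] = []
others-avoids c (x ∷ xs) with x ≡ᵇ c in eq
... | true = others-avoids c xs
... | false = eq ∷ others-avoids c xs

fillB-shape : (c : ℕ) (r q : Word) → All (λ t → (t ≡ᵇ c) ≡ false) q → length q ≡ count (not ∘ (_≡ᵇ c)) r →
              (map (_≡ᵇ c) (fillB c r q) ≡ map (_≡ᵇ c) r) × (others c (fillB c r q) ≡ q)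
fillB-shape c [] [] _ _ = refl , refl
fillB-shape c (x ∷ xs) q qc lq with x ≡ᵇ c
fillB-shape c (x ∷ xs) q qc lq | true with fillB-shape c xs q qc lq
... | pat , oth rewrite ≡ᵇ-refl c = cong (true ∷_) pat , oth
fillB-shape c (x ∷ xs) (y ∷ q) (yc ∷ qc) lq | false with fillB-shape c xs q qc (cong pred lq)
... | pat , oth rewrite yc = cong (false ∷_) pat , cong (y ∷_) oth

B-shape : (c : ℕ) (w : Word) →
          (map (_≡ᵇ c) (B c w) ≡ reverse (map (_≡ᵇ c) w)) × (others c (B c w) ≡ others c w)
B-shape c w with fillB-shape c (reverse w) (others c w) (others-avoids c w)
                   (trans (length-others c w) (sym (count-reverse _ w)))
... | pat , oth = trans pat (reverse-map (_≡ᵇ c) w) , oth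

count-B-pattern : (f : Bool → Bool) (c : ℕ) (w : Word) → count (f ∘ (_≡ᵇ c)) (B c w) ≡ count (f ∘ (_≡ᵇ c)) w
count-B-pattern f c w = begin
  count (f ∘ (_≡ᵇ c)) (B c w)       ≡⟨ count-map f (_≡ᵇ c) (B c w) ⟨
  count f (map (_≡ᵇ c) (B c w))     ≡⟨ cong (count f) (proj₁ (B-shape c w)) ⟩
  count f (reverse (map (_≡ᵇ c) w)) ≡⟨ count-reverse f (map (_≡ᵇ c) w) ⟩
  count f (map (_≡ᵇ c) w)           ≡⟨ count-map f (_≡ᵇ c) w ⟩
  count (f ∘ (_≡ᵇ c)) w             ∎
  where open ≡-Reasoning

invBy-B-pattern : (h : Bool → Bool → Bool) (c : ℕ) (w : Word) →
                  invBy (λ x y → h (x ≡ᵇ c) (y ≡ᵇ c)) (B c w) ≡ invBy (λ x y → h (y ≡ᵇ c) (x ≡ᵇ c)) w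
invBy-B-pattern h c w = begin
  invBy (λ x y → h (x ≡ᵇ c) (y ≡ᵇ c)) (B c w) ≡⟨ invBy-map h (_≡ᵇ c) (B c w) ⟨
  invBy h (map (_≡ᵇ c) (B c w))               ≡⟨ cong (invBy h) (proj₁ (B-shape c w)) ⟩
  invBy h (reverse (map (_≡ᵇ c) w))           ≡⟨ invBy-reverse h (map (_≡ᵇ c) w) ⟩
  invBy (flip h) (map (_≡ᵇ c) w)              ≡⟨ invBy-map (flip h) (_≡ᵇ c) w ⟩
  invBy (λ x y → h (y ≡ᵇ c) (x ≡ᵇ c)) w       ∎
  where open ≡-Reasoning

count-B : (p : ℕ → Bool) (c : ℕ) (w : Word) → count p (B c w) ≡ count p w
count-B p c w = begin
  count p (B c w)
    ≡⟨ count-others p c (B c w) ⟩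
  count p (others c (B c w)) + count (λ y → (y ≡ᵇ c) ∧ p y) (B c w)
    ≡⟨ cong₂ _+_ (cong (count p) (proj₂ (B-shape c w))) (at-c (B c w)) ⟩
  count p (others c w) + count (λ y → (y ≡ᵇ c) ∧ p c) (B c w)
    ≡⟨ cong (count p (others c w) +_) (count-B-pattern (_∧ p c) c w) ⟩
  count p (others c w) + count (λ y → (y ≡ᵇ c) ∧ p c) w
    ≡⟨ cong (count p (others c w) +_) (at-c w) ⟨
  count p (others c w) + count (λ y → (y ≡ᵇ c) ∧ p y) w
    ≡⟨ count-others p c w ⟨
  count p w ∎
  where
  open ≡-Reasoning
  at-c : (v : Word) → count (λ y → (y ≡ᵇ c) ∧ p y) v ≡ count (λ y → (y ≡ᵇ c) ∧ p c) v
  at-c v = count-cong v (All.universal (λ y → ≡ᵇ∧-subst p y c) v)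

tripleCond-involving-z : ∀ c x y → involving c (λ x y → tripleCond x y c) x y ≡ (x ≡ᵇ c) ∧ not (y ≡ᵇ c)
tripleCond-involving-z (suc c) (suc x) (suc y) = tripleCond-involving-z c x y
tripleCond-involving-z zero zero zero = refl
tripleCond-involving-z zero zero (suc y) = refl
tripleCond-involving-z zero (suc x) zero = refl
tripleCond-involving-z zero (suc x) (suc y) = refl
tripleCond-involving-z (suc c) zero zero = refl
tripleCond-involving-z (suc c) zero (suc y) rewrite ∧-identityʳ (c <ᵇ y) | ∨-identityʳ (c <ᵇ y) = ≡ᵇ∧<ᵇ y c
tripleCond-involving-z (suc c) (suc x) zero with x ≡ᵇ c | x <ᵇ c
... | true | _ = refl
... | false | _ = refl

tripleCond-involving-1+z : ∀ j x y →
  involving (suc j) (λ x y → tripleCond x y j) x y ≡ (y ≡ᵇ suc j) ∧ not (x ≡ᵇ suc j)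
tripleCond-involving-1+z (suc j) (suc x) (suc y) = tripleCond-involving-1+z j x y
tripleCond-involving-1+z zero zero zero = refl
tripleCond-involving-1+z zero zero (suc zero) = refl
tripleCond-involving-1+z zero zero (suc (suc y)) = refl
tripleCond-involving-1+z zero (suc zero) zero = refl
tripleCond-involving-1+z zero (suc zero) (suc zero) = refl
tripleCond-involving-1+z zero (suc zero) (suc (suc y)) = refl
tripleCond-involving-1+z zero (suc (suc x)) zero = refl
tripleCond-involving-1+z zero (suc (suc x)) (suc zero) = refl
tripleCond-involving-1+z zero (suc (suc x)) (suc (suc y)) = refl
tripleCond-involving-1+z (suc j) zero zero = refl
tripleCond-involving-1+z (suc j) zero (suc y) rewrite ∧-identityʳ (j <ᵇ y) | ∨-identityʳ (j <ᵇ y)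
  with y ≡ᵇ suc j in eq
... | false = refl
... | true with refl ← ≡ᵇ-true⇒≡ y (suc j) eq = c<ᵇ1+c j
tripleCond-involving-1+z (suc j) (suc x) zero with x ≡ᵇ suc j in eq
... | false = refl
... | true with refl ← ≡ᵇ-true⇒≡ x (suc j) eq rewrite 1+c≡ᵇc j | 1+c<ᵇc j = refl

tripleCond-1+z : ∀ j x y → (x ≡ᵇ suc j) ≡ false → (y ≡ᵇ suc j) ≡ false →
                 tripleCond x y (suc j) ≡ tripleCond x y j
tripleCond-1+z (suc j) (suc x) (suc y) hx hy = tripleCond-1+z j x y hx hy
tripleCond-1+z zero zero zero _ _ = refl
tripleCond-1+z zero zero (suc (suc y)) _ _ = refl
tripleCond-1+z zero (suc (suc x)) zero _ _ = refl
tripleCond-1+z zero (suc (suc x)) (suc (suc y)) _ _ = refl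
tripleCond-1+z (suc j) zero zero _ _ = refl
tripleCond-1+z (suc j) zero (suc y) _ hy rewrite 1+j<ᵇy j y hy = refl
tripleCond-1+z (suc j) (suc x) zero hx _ rewrite hx | <ᵇ-suc x j with x ≡ᵇ j | x <ᵇ j
... | false | false = refl
... | false | true = refl
... | true | false = refl
... | true | true = refl

tripleCond-0 : ∀ {x y} → 1 ≤ x → 1 ≤ y → tripleCond x y 0 ≡ (y <ᵇ x)
tripleCond-0 {suc x} {suc y} _ _ with y <ᵇ x
... | true = refl
... | false = refl

triplesOver : ℕ → Word → ℕ
triplesOver z = invBy (λ x y → tripleCond x y z)

triplesOver-suc-others : ∀ j w → triplesOver (suc j) (others (suc j) w) ≡ triplesOver j (others (suc j) w)
triplesOver-suc-others j w =
  invBy-cong-on (λ t → (t ≡ᵇ suc j) ≡ false) (others (suc j) w) (others-avoids (suc j) w)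
    (λ {x} {y} hx hy → tripleCond-1+z j x y hx hy)

triplesOver-B-up : ∀ j w → triplesOver (suc j) (B (suc j) w) ≡ triplesOver j w
triplesOver-B-up j w = begin
  triplesOver (suc j) (B c w)
    ≡⟨ invBy-others _ c (B c w) ⟩
  triplesOver (suc j) (others c (B c w)) + invBy (involving c (λ x y → tripleCond x y c)) (B c w)
    ≡⟨ cong₂ _+_ (cong (triplesOver c) (proj₂ (B-shape c w))) (invBy-cong (tripleCond-involving-z c) (B c w)) ⟩
  triplesOver (suc j) (others c w) + invBy (λ x y → (x ≡ᵇ c) ∧ not (y ≡ᵇ c)) (B c w)
    ≡⟨ cong₂ _+_ (triplesOver-suc-others j w) (invBy-B-pattern (λ a b → a ∧ not b) c w) ⟩
  triplesOver j (others c w) + invBy (λ x y → (y ≡ᵇ c) ∧ not (x ≡ᵇ c)) w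
    ≡⟨ cong (triplesOver j (others c w) +_) (invBy-cong (tripleCond-involving-1+z j) w) ⟨
  triplesOver j (others c w) + invBy (involving c (λ x y → tripleCond x y j)) w
    ≡⟨ invBy-others _ c w ⟨
  triplesOver j w ∎
  where
  open ≡-Reasoning
  c = suc j

triplesOver-B-down : ∀ j w → triplesOver j (B (suc j) w) ≡ triplesOver (suc j) w
triplesOver-B-down j w = begin
  triplesOver j (B c w)
    ≡⟨ invBy-others _ c (B c w) ⟩
  triplesOver j (others c (B c w)) + invBy (involving c (λ x y → tripleCond x y j)) (B c w)
    ≡⟨ cong₂ _+_ (cong (triplesOver j) (proj₂ (B-shape c w))) (invBy-cong (tripleCond-involving-1+z j) (B c w)) ⟩
  triplesOver j (others c w) + invBy (λ x y → (y ≡ᵇ c) ∧ not (x ≡ᵇ c)) (B c w)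
    ≡⟨ cong₂ _+_ (sym (triplesOver-suc-others j w)) (invBy-B-pattern (λ a b → b ∧ not a) c w) ⟩
  triplesOver (suc j) (others c w) + invBy (λ x y → (x ≡ᵇ c) ∧ not (y ≡ᵇ c)) w
    ≡⟨ cong (triplesOver c (others c w) +_) (invBy-cong (tripleCond-involving-z c) w) ⟨
  triplesOver (suc j) (others c w) + invBy (involving c (λ x y → tripleCond x y c)) w
    ≡⟨ invBy-others _ c w ⟨
  triplesOver (suc j) w ∎
  where
  open ≡-Reasoning
  c = suc j

triplesOver-upLift : ∀ i k w → triplesOver (i + k) (upLift i k w) ≡ triplesOver i w
triplesOver-upLift i zero w rewrite +-identityʳ i = refl
triplesOver-upLift i (suc k) w rewrite +-suc i k =
  trans (triplesOver-upLift (suc i) k (B (suc i) w)) (triplesOver-B-up i w)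

triplesOver-downLift : ∀ j k w → k ≤ j → triplesOver (j ∸ k) (downLift j k w) ≡ triplesOver j w
triplesOver-downLift j zero w _ = refl
triplesOver-downLift (suc j) (suc k) w (s≤s k≤j) =
  trans (triplesOver-downLift j k (B (suc j) w) k≤j) (triplesOver-B-down j w)

triplesOver-Bto : ∀ a b w → triplesOver b (Bto a b w) ≡ triplesOver a w
triplesOver-Bto a b w with a ≤ᵇ b in a≤ᵇb
... | true = subst (λ z → triplesOver z (upLift a (b ∸ a) w) ≡ triplesOver a w)
                  (m+[n∸m]≡n (≤ᵇ-true⇒≤ a b a≤ᵇb)) (triplesOver-upLift a (b ∸ a) w)
... | false = subst (λ z → triplesOver z (downLift a (a ∸ b) w) ≡ triplesOver a w)
                   (m∸[m∸n]≡n (≤ᵇ-false⇒≥ a b a≤ᵇb)) (triplesOver-downLift a (a ∸ b) w (m∸n≤m a b))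

count-upLift : (p : ℕ → Bool) → ∀ i k w → count p (upLift i k w) ≡ count p w
count-upLift p i zero w = refl
count-upLift p i (suc k) w = trans (count-upLift p (suc i) k (B (suc i) w)) (count-B p (suc i) w)

count-downLift : (p : ℕ → Bool) → ∀ j k w → count p (downLift j k w) ≡ count p w
count-downLift p j zero w = refl
count-downLift p zero (suc k) w = refl
count-downLift p (suc j) (suc k) w = trans (count-downLift p j k (B (suc j) w)) (count-B p (suc j) w)

count-Bto : (p : ℕ → Bool) → ∀ a b w → count p (Bto a b w) ≡ count p w
count-Bto p a b w with a ≤ᵇ b
... | true = count-upLift p a (b ∸ a) w
... | false = count-downLift p a (a ∸ b) w

length-Bto : ∀ a b w → length (Bto a b w) ≡ length w
length-Bto a b w = begin
  length (Bto a b w)                ≡⟨ count-length (Bto a b w) ⟨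
  count (λ _ → true) (Bto a b w)    ≡⟨ count-Bto (λ _ → true) a b w ⟩
  count (λ _ → true) w              ≡⟨ count-length w ⟩
  length w                          ∎
  where open ≡-Reasoning

count-elevGo : (p : ℕ → Bool) → ∀ q as w → count p (elevGo q as w) ≡ count p w
count-elevGo p q [] w = refl
count-elevGo p q (a ∷ as) w with Bto q a w | count-Bto p q a w
... | [] | eq = eq
... | x ∷ xs | eq = trans (cong ((if p x then 1 else 0) +_) (count-elevGo p a as xs)) eq

length-elevGo : ∀ q as w → length (elevGo q as w) ≡ length w
length-elevGo q as w = begin
  length (elevGo q as w)               ≡⟨ count-length (elevGo q as w) ⟨
  count (λ _ → true) (elevGo q as w)   ≡⟨ count-elevGo (λ _ → true) q as w ⟩
  count (λ _ → true) w                 ≡⟨ count-length w ⟩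
  length w                             ∎
  where open ≡-Reasoning

map-proj₁-zip : {A B : Set} (u : List A) (v : List B) → length u ≤ length v → map proj₁ (zip u v) ≡ u
map-proj₁-zip [] v _ = refl
map-proj₁-zip (x ∷ u) (y ∷ v) (s≤s u≤v) = cong (x ∷_) (map-proj₁-zip u v u≤v)

triplesCols-elevGo : ∀ q as w → length w ≤ length as → triplesCols (zip (elevGo q as w) as) ≡ triplesOver q w
triplesCols-elevGo q [] [] _ = refl
triplesCols-elevGo q (a ∷ as) w w≤as with Bto q a w | triplesOver-Bto q a w | length-Bto q a w
... | [] | eq | _ = eq
... | x ∷ xs | eq | len = trans (cong₂ _+_ later (triplesCols-elevGo a as xs xs≤as)) eq
  where
  xs≤as : length xs ≤ length as
  xs≤as = ≤-pred (subst (_≤ length (a ∷ as)) (sym len) w≤as)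
  later : count (λ y → tripleCond x y a) (map proj₁ (zip (elevGo a as xs) as)) ≡ count (λ y → tripleCond x y a) xs
  later = trans (cong (count (λ y → tripleCond x y a))
                      (map-proj₁-zip (elevGo a as xs) as (subst (_≤ length as) (sym (length-elevGo a as xs)) xs≤as)))
                (count-elevGo (λ y → tripleCond x y a) a as xs)

inv≡invBy : ∀ w → inv w ≡ invBy (λ x y → y <ᵇ x) w
inv≡invBy [] = refl
inv≡invBy (x ∷ w) = cong (count (λ y → y <ᵇ x) w +_) (inv≡invBy w)

triplesOver-0 : ∀ w → All (1 ≤_) w → triplesOver 0 w ≡ inv w
triplesOver-0 w pos = trans (invBy-cong-on (1 ≤_) w pos tripleCond-0) (sym (inv≡invBy w))

pairsBottom≡inv : ∀ r → pairsBottom r ≡ inv r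
pairsBottom≡inv [] = refl
pairsBottom≡inv (x ∷ r) = cong (count (λ y → y <ᵇ x) r +_) (pairsBottom≡inv r)

triplesRow-ψ : ∀ prev r → length r ≤ length prev → All (1 ≤_) r → triplesRow prev (ψ prev r) ≡ inv r
triplesRow-ψ prev r r≤prev pos = trans (triplesCols-elevGo 0 prev r r≤prev) (triplesOver-0 r pos)

Decreasing-head : ∀ {r r′} rs → length r′ ≡ length r → Decreasing (r ∷ rs) → Decreasing (r′ ∷ rs)
Decreasing-head [] _ _ = tt
Decreasing-head (s ∷ rs) eq (s≤r , dec) = subst (length s ≤_) (sym eq) s≤r , dec

triplesAll-ψRows : ∀ prev rs → Decreasing (prev ∷ rs) → All (All (1 ≤_)) rs →
                   triplesAll prev (ψRows prev rs) ≡ sum (map inv rs)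
triplesAll-ψRows prev [] _ _ = refl
triplesAll-ψRows prev (r ∷ rs) (r≤prev , dec) (pos ∷ poss) =
  cong₂ _+_ (triplesRow-ψ prev r r≤prev pos)
            (triplesAll-ψRows (ψ prev r) rs (Decreasing-head rs (length-elevGo 0 prev r) dec) poss)

mainTheorem3 : (F : Filling) → IsFilling F → sum (map inv F) ≡ invF (ψF F)
mainTheorem3 [] _ = refl
mainTheorem3 (r ∷ rs) (_ , dec , _ ∷ poss) =
  sym (cong₂ _+_ (pairsBottom≡inv r) (triplesAll-ψRows r rs dec poss))
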